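{- Let $\mathsf{K}_4$ be the complete geometric graph on $4$ points in convex position. Then $\alpha_1(\mathsf{K}_4)=4$ and $\psi_1(\mathsf{K}_4)=5$.
   Context: Two edges of a geometric graph (straight-line drawing) intersect if they share an endpoint or cross; otherwise they are disjoint. An edge coloring with $k$ colors is a surjective map from the edge set onto $\{1,\dots,k\}$. It is proper if any two edges of the same color are disjoint, and complete if for every pair of distinct colors there is an edge of the first color and an edge of the second color that intersect. $\alpha_1$ is the largest $k$ admitting a proper and complete edge coloring with $k$ colors; $\psi_1$ is the largest $k$ admitting a complete edge coloring with $k$ colors. -}

module Defs where

open import Data.Nat using (ℕ; _≤_)
open import Data.Fin using (Fin; _<_)
open import Data.Product using (Σ; _×_; _,_; ∃; proj₁)
open import Data.Sum using (_⊎_)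
open import Relation.Binary.PropositionalEquality using (_≡_; _≢_)
open import Relation.Nullary using (¬_)

-- The 4 points of K4 in convex position, labelled 0,1,2,3 in cyclic
-- (e.g. counterclockwise) order along the convex hull.
Point : Set
Point = Fin 4

Edge : Set
Edge = Σ (Point × Point) (λ p → proj₁ p < Data.Product.proj₂ p)

src tgt : Edge → Point
src ((a , _) , _) = a
tgt ((_ , b) , _) = b

ShareEndpoint : Edge → Edge → Set
ShareEndpoint e f =
  (src e ≡ src f) ⊎ (src e ≡ tgt f) ⊎ (tgt e ≡ src f) ⊎ (tgt e ≡ tgt f)

-- For points in convex position (in cyclic order), the segments ab and cd
-- (a<b, c<d, all four endpoints distinct) cross iff their endpoints
-- interleave along the cyclic order.
Cross : Edge → Edge → Set
Cross e f =
  (src e < src f × src f < tgt e × tgt e < tgt f)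
  ⊎ (src f < src e × src e < tgt f × tgt f < tgt e)

Intersect : Edge → Edge → Set
Intersect e f = ShareEndpoint e f ⊎ Cross e f

Disjoint : Edge → Edge → Set
Disjoint e f = ¬ Intersect e f

Surjective : {k : ℕ} → (Edge → Fin k) → Set
Surjective {k} c = (i : Fin k) → ∃ λ e → c e ≡ i

Proper : {k : ℕ} → (Edge → Fin k) → Set
Proper c = (e f : Edge) → e ≢ f → c e ≡ c f → Disjoint e f

Complete : {k : ℕ} → (Edge → Fin k) → Set
Complete {k} c = (i j : Fin k) → i ≢ j →
  ∃ λ e → ∃ λ f → c e ≡ i × c f ≡ j × Intersect e f

HasProperCompleteColoring : ℕ → Set
HasProperCompleteColoring k =
  Σ (Edge → Fin k) λ c → Surjective c × Proper c × Complete c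

HasCompleteColoring : ℕ → Set
HasCompleteColoring k =
  Σ (Edge → Fin k) λ c → Surjective c × Complete c

IsLargest : (ℕ → Set) → ℕ → Set
IsLargest P n = P n × ((k : ℕ) → P k → k ≤ n)

Alpha1Is : ℕ → Set
Alpha1Is = IsLargest HasProperCompleteColoring

Psi1Is : ℕ → Set
Psi1Is = IsLargest HasCompleteColoring

-- In convex position the two diagonals cross and every other pair of edges
-- shares an endpoint, except the two pairs of opposite sides {01,23} and
-- {03,12}; so every edge is disjoint from at most one other edge.
-- In a complete colouring, two disjoint edges cannot both be alone in their
-- colour classes, so some colour is repeated and at most 5 colours occur.
-- If the colouring is also proper, the colour class of p can only contain
-- edges disjoint from p, i.e. its opposite side q; completeness between the
-- classes of p and q then forces c p ≡ c q.  Both pairs of opposite sides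
-- are thus monochromatic, leaving at most 4 colours.
module Submission where

open import Defs
open import Data.Nat using (suc; z≤n; s≤s) renaming (_≤_ to _≤ℕ_)
open import Data.Fin using (Fin; zero; suc; punchIn; punchOut)
open import Data.Fin.Properties using (_≟_; _<?_; all?; any?; <-irrelevant; injective⇒≤; punchIn-punchOut)
open import Data.Product using (_×_; _,_; ∃; ∃₂; proj₁; proj₂)
open import Data.Product.Properties using (≡-dec)
open import Data.Sum using (_⊎_; inj₁; inj₂)
open import Data.Empty using (⊥-elim)
open import Function using (_∘_)
open import Relation.Binary.PropositionalEquality using (_≡_; _≢_; refl; sym; trans; cong; subst)
open import Relation.Nullary using (Dec; yes; no)
open import Relation.Nullary.Decidable using (map′; from-yes; ¬?; _⊎-dec_; _×-dec_; _→-dec_)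

surjection⇒≤ : ∀ {n k} (f : Fin n → Fin k) → (∀ i → ∃ λ j → f j ≡ i) → k ≤ℕ n
surjection⇒≤ f surj = injective⇒≤ {f = section} section-injective
  where
  section : _ → _
  section i = proj₁ (surj i)

  section-injective : ∀ {i j} → section i ≡ section j → i ≡ j
  section-injective {i} {j} eq = trans (sym (proj₂ (surj i))) (trans (cong f eq) (proj₂ (surj j)))

covering⇒≤ : ∀ {A : Set} {n k} (c : A → Fin k) → (∀ i → ∃ λ x → c x ≡ i) →
             (r : Fin n → A) → (∀ x → ∃ λ j → c (r j) ≡ c x) → k ≤ℕ n
covering⇒≤ c surj r covers = surjection⇒≤ (c ∘ r) λ i →
  let (x , cx≡i) = surj i; (j , crj≡cx) = covers x in j , trans crj≡cx cx≡i

collision⇒≤ : ∀ {n k} (c : Fin (suc n) → Fin k) → (∀ i → ∃ λ x → c x ≡ i) →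
              ∀ {x y} → x ≢ y → c x ≡ c y → k ≤ℕ n
-- punchIn y enumerates every point but y, and the colour of y is also that of x.
collision⇒≤ c surj {x} {y} x≢y cx≡cy = covering⇒≤ c surj (punchIn y) covers
  where
  covers : ∀ z → ∃ λ j → c (punchIn y j) ≡ c z
  covers z with z ≟ y
  ... | yes refl = punchOut (x≢y ∘ sym) , trans (cong c (punchIn-punchOut (x≢y ∘ sym))) cx≡cy
  ... | no z≢y   = punchOut (z≢y ∘ sym) , cong c (punchIn-punchOut (z≢y ∘ sym))

pattern e01 = ((zero , suc zero) , s≤s z≤n)
pattern e02 = ((zero , suc (suc zero)) , s≤s z≤n)
pattern e03 = ((zero , suc (suc (suc zero))) , s≤s z≤n)
pattern e12 = ((suc zero , suc (suc zero)) , s≤s (s≤s z≤n))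
pattern e13 = ((suc zero , suc (suc (suc zero))) , s≤s (s≤s z≤n))
pattern e23 = ((suc (suc zero) , suc (suc (suc zero))) , s≤s (s≤s (s≤s z≤n)))

edgeOf : Fin 6 → Edge
edgeOf zero                            = e01
edgeOf (suc zero)                      = e02
edgeOf (suc (suc zero))                = e03
edgeOf (suc (suc (suc zero)))          = e12
edgeOf (suc (suc (suc (suc zero))))    = e13
edgeOf (suc (suc (suc (suc (suc _))))) = e23

index : Edge → Fin 6
index e01 = zero
index e02 = suc zero
index e03 = suc (suc zero)
index e12 = suc (suc (suc zero))
index e13 = suc (suc (suc (suc zero)))
index e23 = suc (suc (suc (suc (suc zero))))

edgeOf-index : ∀ e → edgeOf (index e) ≡ e
edgeOf-index e01 = refl
edgeOf-index e02 = refl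
edgeOf-index e03 = refl
edgeOf-index e12 = refl
edgeOf-index e13 = refl
edgeOf-index e23 = refl

index-injective : ∀ {e f} → index e ≡ index f → e ≡ f
index-injective {e} {f} eq = trans (sym (edgeOf-index e)) (trans (cong edgeOf eq) (edgeOf-index f))

∀-edge? : {P : Edge → Set} → (∀ e → Dec (P e)) → Dec (∀ e → P e)
∀-edge? {P} P? = map′ (λ ∀i e → subst P (edgeOf-index e) (∀i (index e))) (λ ∀e i → ∀e (edgeOf i))
                      (all? (P? ∘ edgeOf))

∃-edge? : {P : Edge → Set} → (∀ e → Dec (P e)) → Dec (∃ P)
∃-edge? {P} P? = map′ (λ (i , p) → edgeOf i , p) (λ (e , p) → index e , subst P (sym (edgeOf-index e)) p)
                      (any? (P? ∘ edgeOf))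

_≟ᴱ_ : (e f : Edge) → Dec (e ≡ f)
_≟ᴱ_ = ≡-dec (≡-dec _≟_ _≟_) λ p q → yes (<-irrelevant p q)

intersect? : (e f : Edge) → Dec (Intersect e f)
intersect? e f =
  ((src e ≟ src f) ⊎-dec (src e ≟ tgt f) ⊎-dec (tgt e ≟ src f) ⊎-dec (tgt e ≟ tgt f))
  ⊎-dec ((src e <? src f) ×-dec (src f <? tgt e) ×-dec (tgt e <? tgt f))
        ⊎-dec ((src f <? src e) ×-dec (src e <? tgt f) ×-dec (tgt f <? tgt e))

surjective? : ∀ {k} (c : Edge → Fin k) → Dec (Surjective c)
surjective? c = all? λ i → ∃-edge? λ e → c e ≟ i

proper? : ∀ {k} (c : Edge → Fin k) → Dec (Proper c)
proper? c = ∀-edge? λ e → ∀-edge? λ f → ¬? (e ≟ᴱ f) →-dec (c e ≟ c f) →-dec ¬? (intersect? e f)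

complete? : ∀ {k} (c : Edge → Fin k) → Dec (Complete c)
complete? c = all? λ i → all? λ j → ¬? (i ≟ j) →-dec
  ∃-edge? λ e → ∃-edge? λ f → (c e ≟ i) ×-dec (c f ≟ j) ×-dec intersect? e f

intersect-refl : ∀ e → Intersect e e
intersect-refl e = inj₁ (inj₁ refl)

intersect-sym : ∀ {e f} → Intersect e f → Intersect f e
intersect-sym (inj₁ (inj₁ eq))               = inj₁ (inj₁ (sym eq))
intersect-sym (inj₁ (inj₂ (inj₁ eq)))        = inj₁ (inj₂ (inj₂ (inj₁ (sym eq))))
intersect-sym (inj₁ (inj₂ (inj₂ (inj₁ eq)))) = inj₁ (inj₂ (inj₁ (sym eq)))
intersect-sym (inj₁ (inj₂ (inj₂ (inj₂ eq)))) = inj₁ (inj₂ (inj₂ (inj₂ (sym eq))))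
intersect-sym (inj₂ (inj₁ cross))            = inj₂ (inj₂ cross)
intersect-sym (inj₂ (inj₂ cross))            = inj₂ (inj₁ cross)

disjoint-01-23 : Disjoint e01 e23
disjoint-01-23 = from-yes (¬? (intersect? e01 e23))

disjoint-03-12 : Disjoint e03 e12
disjoint-03-12 = from-yes (¬? (intersect? e03 e12))

disjoint-unique : ∀ e f g → Disjoint e g → Disjoint f g → e ≡ f
disjoint-unique = from-yes (∀-edge? λ e → ∀-edge? λ f → ∀-edge? λ g →
  ¬? (intersect? e g) →-dec ¬? (intersect? f g) →-dec (e ≟ᴱ f))

complete⇒colour-repeated : ∀ {k} {c : Edge → Fin k} → Complete c → ∀ {p q} → Disjoint p q → c p ≢ c q →
                           ∃ λ e → (e ≢ p × c e ≡ c p) ⊎ (e ≢ q × c e ≡ c q)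
complete⇒colour-repeated {c = c} complete {p} {q} p∩q=∅ cp≢cq
  with complete (c p) (c q) cp≢cq
... | e , f , ce≡cp , cf≡cq , e∩f with e ≟ᴱ p | f ≟ᴱ q
...   | no e≢p   | _        = e , inj₁ (e≢p , ce≡cp)
...   | yes _    | no f≢q   = f , inj₂ (f≢q , cf≡cq)
...   | yes refl | yes refl = ⊥-elim (p∩q=∅ e∩f)

complete⇒collision : ∀ {k} {c : Edge → Fin k} → Complete c → ∀ p q → Disjoint p q →
                     ∃₂ λ e f → e ≢ f × c e ≡ c f
complete⇒collision {c = c} complete p q p∩q=∅ with c p ≟ c q
... | yes cp≡cq = p , q , (λ { refl → p∩q=∅ (intersect-refl p) }) , cp≡cq
... | no cp≢cq with complete⇒colour-repeated complete p∩q=∅ cp≢cq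
...   | e , inj₁ (e≢p , ce≡cp) = e , p , e≢p , ce≡cp
...   | e , inj₂ (e≢q , ce≡cq) = e , q , e≢q , ce≡cq

proper-complete⇒disjoint-same-colour : ∀ {k} {c : Edge → Fin k} → Proper c → Complete c →
                                       ∀ {p q} → Disjoint p q → c p ≡ c q
proper-complete⇒disjoint-same-colour {c = c} proper complete {p} {q} p∩q=∅ with c p ≟ c q
... | yes cp≡cq = cp≡cq
... | no cp≢cq with complete⇒colour-repeated complete p∩q=∅ cp≢cq
...   | e , inj₁ (e≢p , ce≡cp) =
  ⊥-elim (cp≢cq (trans (sym ce≡cp) (cong c (disjoint-unique e q p (proper e p e≢p ce≡cp) (p∩q=∅ ∘ intersect-sym {q} {p})))))
...   | e , inj₂ (e≢q , ce≡cq) =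
  ⊥-elim (cp≢cq (trans (cong c (disjoint-unique p e q p∩q=∅ (proper e q e≢q ce≡cq))) ce≡cq))

alphaColouring : Edge → Fin 4
alphaColouring e01 = zero
alphaColouring e23 = zero
alphaColouring e03 = suc zero
alphaColouring e12 = suc zero
alphaColouring e02 = suc (suc zero)
alphaColouring e13 = suc (suc (suc zero))

psiColouring : Edge → Fin 5
psiColouring e01 = zero
psiColouring e03 = zero
psiColouring e23 = suc zero
psiColouring e12 = suc (suc zero)
psiColouring e02 = suc (suc (suc zero))
psiColouring e13 = suc (suc (suc (suc zero)))

alpha-attained : HasProperCompleteColoring 4
alpha-attained = alphaColouring , from-yes (surjective? alphaColouring) ,
                 from-yes (proper? alphaColouring) , from-yes (complete? alphaColouring)

psi-attained : HasCompleteColoring 5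
psi-attained = psiColouring , from-yes (surjective? psiColouring) , from-yes (complete? psiColouring)

alpha-bound : ∀ k → HasProperCompleteColoring k → k ≤ℕ 4
alpha-bound k (c , surjective , proper , complete) = covering⇒≤ c surjective representative covers
  where
  representative : Fin 4 → Edge
  representative zero                   = e01
  representative (suc zero)             = e03
  representative (suc (suc zero))       = e02
  representative (suc (suc (suc zero))) = e13

  covers : ∀ e → ∃ λ j → c (representative j) ≡ c e
  covers e01 = zero , refl
  covers e23 = zero , proper-complete⇒disjoint-same-colour proper complete disjoint-01-23
  covers e03 = suc zero , refl
  covers e12 = suc zero , proper-complete⇒disjoint-same-colour proper complete disjoint-03-12
  covers e02 = suc (suc zero) , refl
  covers e13 = suc (suc (suc zero)) , refl

psi-bound : ∀ k → HasCompleteColoring k → k ≤ℕ 5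
psi-bound k (c , surjective , complete) with complete⇒collision {c = c} complete e01 e23 disjoint-01-23
... | e , f , e≢f , ce≡cf = collision⇒≤ (c ∘ edgeOf) surjective′ (e≢f ∘ index-injective) colour-collision
  where
  surjective′ : ∀ i → ∃ λ j → c (edgeOf j) ≡ i
  surjective′ i with surjective i
  ... | x , cx≡i = index x , trans (cong c (edgeOf-index x)) cx≡i

  colour-collision : c (edgeOf (index e)) ≡ c (edgeOf (index f))
  colour-collision = trans (cong c (edgeOf-index e)) (trans ce≡cf (sym (cong c (edgeOf-index f))))

mainTheorem7 : Alpha1Is 4 × Psi1Is 5
mainTheorem7 = (alpha-attained , alpha-bound) , (psi-attained , psi-bound)
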